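{- Let $\Gamma$ be a finite simple connected graph and $p_\Gamma(\lambda)$ its chromatic polynomial. Then the graded Euler characteristic of the reduced cochain complex equals the reduced chromatic polynomial $\widetilde p_\Gamma(\lambda)=\lambda^{ -1}p_\Gamma(\lambda)$ evaluated at $\lambda=1+q$: $$\sum_{i,j}(-1)^i q^j\dim\widetilde C^{i,j}(\Gamma)=\frac{p_\Gamma(1+q)}{1+q}.$$
   Context: Reduced chromatic cochain complex. Let $\Gamma$ be a finite graph with vertex set $V$, edge set $E$ with a fixed ordering, and a chosen base vertex $v_0\in V$. For $s\subseteq E$ let $[\Gamma:s]$ be the spanning subgraph $(V,s)$. A reduced enhanced state is a pair $S=(s,c)$ where $c$ assigns to each connected component of $[\Gamma:s]$ a color in $\{1,x\}$, with the component containing $v_0$ colored $x$; its dimension is $i=|s|$ and its degree is $j=(\text{number of components colored }x)-1$. $\widetilde C^{i,j}(\Gamma)$ is the real vector space with basis the reduced enhanced states of dimension $i$ and degree $j$. The differential $d:\widetilde C^{i,j}\to\widetilde C^{i+1,j}$ is $d(s,c)=\sum_{e\in E\setminus s}(-1)^{|\{e'\in s:\ e'\text{ precedes }e\}|}S_e$, where: if both endpoints of $e$ lie in one component of $[\Gamma:s]$, $S_e=(s\cup\{e\},c)$; otherwise the two components joined by $e$ merge, other components keep their colors, the merged component gets the product color ($1\cdot1=1$, $1\cdot x=x\cdot1=x$), and $S_e=0$ if both were colored $x$. $p_\Gamma(\lambda)$ is the number of proper vertex colorings of $\Gamma$ with $\lambda$ colors, as a polynomial in $\lambda$. -}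

module Defs where

open import Data.Nat as ℕ using (ℕ; zero; suc; _≤_)
open import Data.Integer as ℤ using (ℤ; +_)
open import Data.Fin as Fin using (Fin)
open import Data.Fin.Subset using (Subset; _∈_; ∣_∣; ⊤)
open import Data.Vec using (Vec; lookup)
open import Data.Product using (Σ; ∃; _×_; _,_; proj₁; proj₂)
open import Data.Sum using (_⊎_)
open import Data.Refinement using (Refinement)
open import Function.Bundles using (_↔_)
open import Relation.Binary.PropositionalEquality using (_≡_; _≢_)
open import Relation.Binary.Construct.Closure.ReflexiveTransitive using (Star)

-- Finite graphs.  Vertices are Fin n; the edges are indexed by Fin m,
-- and the fixed edge ordering is the order of Fin m.  Edge e joins
-- src e and tgt e.

record Graph : Set where
  field
    n    : ℕ
    m    : ℕ
    edge : Fin m → Fin n × Fin n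

  src tgt : Fin m → Fin n
  src e = proj₁ (edge e)
  tgt e = proj₂ (edge e)

open Graph public

IsSimple : Graph → Set
IsSimple Γ =
  (∀ e → src Γ e ≢ tgt Γ e) ×
  (∀ e e' → (src Γ e ≡ src Γ e' × tgt Γ e ≡ tgt Γ e')
          ⊎ (src Γ e ≡ tgt Γ e' × tgt Γ e ≡ src Γ e') → e ≡ e')

Adj : (Γ : Graph) → Subset (m Γ) → Fin (n Γ) → Fin (n Γ) → Set
Adj Γ s u v = ∃ λ e → e ∈ s ×
  ((src Γ e ≡ u × tgt Γ e ≡ v) ⊎ (src Γ e ≡ v × tgt Γ e ≡ u))

SameComp : (Γ : Graph) → Subset (m Γ) → Fin (n Γ) → Fin (n Γ) → Set
SameComp Γ s = Star (Adj Γ s)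

IsConnected : Graph → Set
IsConnected Γ = ∀ u v → SameComp Γ ⊤ u v

HasCard : Set → ℕ → Set
HasCard A k = Fin k ↔ A

-- A colouring of the components of [Γ : s] by {1, x} is represented by
-- a vertex subset c (c ∋ v  means v's component is coloured x) which
-- is constant on components (i.e. on every edge of s).

RespectsComps : (Γ : Graph) → Subset (m Γ) → Subset (n Γ) → Set
RespectsComps Γ s c = ∀ u v → Adj Γ s u v → lookup c u ≡ lookup c v

-- Components coloured x, each represented by its least vertex.
XComp : (Γ : Graph) → Subset (m Γ) → Subset (n Γ) → Set
XComp Γ s c = Refinement (Fin (n Γ))
  (λ v → v ∈ c × (∀ u → SameComp Γ s u v → Fin.toℕ v ≤ Fin.toℕ u))

ReducedState : (Γ : Graph) → Fin (n Γ) → ℕ → ℕ → Set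
ReducedState Γ v₀ i j = Refinement (Subset (m Γ) × Subset (n Γ))
  (λ sc → let s = proj₁ sc ; c = proj₂ sc in
     RespectsComps Γ s c × v₀ ∈ c × ∣ s ∣ ≡ i
     × HasCard (XComp Γ s c) (suc j))

ProperColouring : Graph → ℕ → Set
ProperColouring Γ k = Refinement (Vec (Fin k) (n Γ))
  (λ f → ∀ e → lookup f (src Γ e) ≢ lookup f (tgt Γ e))

sumUpTo : ℕ → (ℕ → ℤ) → ℤ
sumUpTo zero    f = f zero
sumUpTo (suc N) f = sumUpTo N f ℤ.+ f (suc N)

sign : ℕ → ℤ
sign zero    = + 1
sign (suc i) = ℤ.- sign i

-- Graded Euler characteristic  Σ_{i,j} (-1)^i q^j dim C^{i,j}, evaluated at
-- an integer q, given the dimensions dim i j.  (dim i j = 0 unless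
-- i ≤ m and j ≤ n, so the finite range loses nothing.)
eulerChar : Graph → (ℕ → ℕ → ℕ) → ℤ → ℤ
eulerChar Γ dim q =
  sumUpTo (m Γ) λ i → sumUpTo (n Γ) λ j →
    sign i ℤ.* (q ℤ.^ j) ℤ.* + dim i j

-- Fix an edge set s and let k(s) be the number of components of [Γ : s].  A reduced
-- state on s colours each component other than the base one freely by 1 or x, so the
-- states on s contribute (1 + q)^(k(s) - 1); times 1 + q this is the number of
-- colourings of the vertices by 1 + q colours that are constant on components.
-- Summing over s with sign (-1)^|s| and exchanging the sums, a colouring g receives
-- Σ_{s ⊆ M(g)} (-1)^|s| = [M(g) = ∅], where M(g) is its set of monochromatic edges,
-- so exactly the proper colourings survive (Whitney's expansion of p_Γ).  Components
-- are represented by their least vertex; a sum over colourings constant on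
-- components factorises once every other vertex copies its representative.
module Submission where

open import Defs
open import Data.Nat using (ℕ; zero; suc)
open import Data.Integer using (+_; _*_)
open import Data.Fin using (Fin)
open import Relation.Binary.PropositionalEquality using (_≡_)

open import Data.Bool using (Bool; true; false; if_then_else_; _∧_; not)
open import Data.Bool.Properties using (∧-identityʳ; T-≡; if-eta)
import Data.Bool.Properties as Bool
open import Data.Fin as Fin using (zero; suc)
open import Data.Fin.Permutation using (↔⇒≡)
open import Data.Fin.Properties using (all?)
import Data.Fin.Properties as Fin
open import Data.Fin.Subset using (Subset; _∈_; ∣_∣)
open import Data.Fin.Subset.Properties using (∣p∣≤n)
open import Data.Integer as ℤ using (ℤ; 0ℤ; 1ℤ; -_; _+_; _^_)
import Data.Integer.Properties as ℤ
open import Data.Integer.Tactic.RingSolver using (solve-∀)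
open import Data.Irrelevant using ([_])
import Data.Nat as ℕ
import Data.Nat.Properties as ℕ
open import Data.Product using (_×_; _,_; proj₁; proj₂; ∃)
open import Data.Product.Properties using (,-injective)
open import Data.Refinement as Ref using (Refinement; value)
open import Data.Refinement.Properties using (value-injective)
open import Data.Sum using (_⊎_; inj₁; inj₂)
open import Data.Unit using (⊤; tt)
open import Data.Vec using (Vec; []; _∷_; lookup)
open import Data.Vec.Properties using (∷-injective; lookup⇒[]=; []=⇒lookup)
open import Function using (_∘_; id; _⇔_; mk⇔; Equivalence; Inverse; mk↔ₛ′)
open import Function.Construct.Composition using (_⇔-∘_; _↔-∘_)
open import Function.Construct.Symmetry using (⇔-sym; ↔-sym)
open import Level using (0ℓ)
open import Relation.Binary using (Rel; Symmetric; DecidableEquality)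
open import Relation.Binary.Construct.Closure.ReflexiveTransitive as Star using (Star; ε; _◅_; _◅◅_)
open import Relation.Binary.Definitions using () renaming (Decidable to Decidable₂)
open import Relation.Binary.PropositionalEquality
  using (refl; sym; trans; cong; cong₂; subst; _≢_; module ≡-Reasoning)
open import Relation.Nullary using (Dec; yes; no; does; ¬_; contradiction)
import Relation.Nullary.Decidable as Dec
open import Relation.Nullary.Decidable
  using (_×-dec_; _⊎-dec_; _→-dec_; ¬?; T?; map′; dec-true; dec-false; recompute)
open import Relation.Unary using (Pred; Decidable)

open import Algebra.Properties.CommutativeMonoid.Sum ℤ.*-1-commutativeMonoid
  using () renaming (sum to ∏; sum-cong-≗ to ∏-cong; ∑-distrib-+ to ∏-distrib; sum-replicate-zero to ∏-1)
open import Algebra.Properties.CommutativeSemigroup ℤ.+-commutativeSemigroup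
  using () renaming (interchange to +-interchange)
open import Algebra.Properties.Semiring.Sum ℤ.+-*-semiring using (sum; sum-cong-≗; sum-replicate-zero)

open ≡-Reasoning

-- Indicators and finite sums

𝟙 : {P : Set} → Dec P → ℤ
𝟙 p = if does p then 1ℤ else 0ℤ

𝟙-yes : {P : Set} (p : Dec P) → P → 𝟙 p ≡ 1ℤ
𝟙-yes p x = cong (λ b → if b then 1ℤ else 0ℤ) (dec-true p x)

𝟙-no : {P : Set} (p : Dec P) → ¬ P → 𝟙 p ≡ 0ℤ
𝟙-no p ¬x = cong (λ b → if b then 1ℤ else 0ℤ) (dec-false p ¬x)

𝟙-cong : {P Q : Set} → P ⇔ Q → (p : Dec P) (q : Dec Q) → 𝟙 p ≡ 𝟙 q
𝟙-cong P⇔Q (yes x) q = sym (𝟙-yes q (Equivalence.to P⇔Q x))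
𝟙-cong P⇔Q (no ¬x) q = sym (𝟙-no q (¬x ∘ Equivalence.from P⇔Q))

𝟙-× : {P Q : Set} (p : Dec P) (q : Dec Q) → 𝟙 (p ×-dec q) ≡ 𝟙 p * 𝟙 q
𝟙-× (yes _) (yes _) = refl
𝟙-× (yes _) (no _)  = refl
𝟙-× (no _)  q       = sym (ℤ.*-zeroˡ (𝟙 q))

𝟙-¬ : {P : Set} (p : Dec P) → 𝟙 (¬? p) ≡ 1ℤ + - 𝟙 p
𝟙-¬ (yes _) = refl
𝟙-¬ (no _)  = refl

𝟙-*-cong : {P : Set} (p : Dec P) {x y : ℤ} → (P → x ≡ y) → 𝟙 p * x ≡ 𝟙 p * y
𝟙-*-cong (yes x) x≡y = cong (1ℤ *_) (x≡y x)
𝟙-*-cong (no _)  _   = refl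

record Additive (X : Set) : Set where
  field
    apply   : (X → ℤ) → ℤ
    apply-+ : ∀ f g → apply (λ x → f x + g x) ≡ apply f + apply g
    apply-0 : apply (λ _ → 0ℤ) ≡ 0ℤ

open Additive

-- ∑-comm is stated for all additive functionals so that linearity and Fubini are special cases.
record Summable (A : Set) : Set₁ where
  field
    ∑        : (A → ℤ) → ℤ
    ∑-cong   : ∀ {f g} → (∀ x → f x ≡ g x) → ∑ f ≡ ∑ g
    ∑-comm   : ∀ {X} (L : Additive X) (F : A → X → ℤ) →
               ∑ (λ a → apply L (F a)) ≡ apply L (λ x → ∑ (λ a → F a x))
    ∑-single : ∀ a f → (∀ x → x ≢ a → f x ≡ 0ℤ) → ∑ f ≡ f a

open Summable {{...}} public

module _ {A : Set} {{_ : Summable A}} where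

  ∑-0 : ∑ (λ (_ : A) → 0ℤ) ≡ 0ℤ
  ∑-0 = ∑-comm zero-functional (λ _ _ → 0ℤ)
    where
    zero-functional : Additive ⊤
    zero-functional = record { apply = λ _ → 0ℤ ; apply-+ = λ _ _ → refl ; apply-0 = refl }

  ∑-+ : ∀ (f g : A → ℤ) → ∑ (λ a → f a + g a) ≡ ∑ f + ∑ g
  ∑-+ f g = ∑-comm pair-sum (λ a b → if b then g a else f a)
    where
    pair-sum : Additive Bool
    pair-sum = record
      { apply   = λ h → h false + h true
      ; apply-+ = λ h k → +-interchange (h false) (k false) (h true) (k true)
      ; apply-0 = refl }

  ∑-*ˡ : ∀ k (f : A → ℤ) → ∑ (λ a → k * f a) ≡ k * ∑ f
  ∑-*ˡ k f = ∑-comm scaling (λ a _ → f a)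
    where
    scaling : Additive ⊤
    scaling = record
      { apply   = λ h → k * h tt
      ; apply-+ = λ h h′ → ℤ.*-distribˡ-+ k (h tt) (h′ tt)
      ; apply-0 = ℤ.*-zeroʳ k }

  ∑-*ʳ : ∀ k (f : A → ℤ) → ∑ (λ a → f a * k) ≡ ∑ f * k
  ∑-*ʳ k f = begin
    ∑ (λ a → f a * k) ≡⟨ ∑-cong (λ a → ℤ.*-comm (f a) k) ⟩
    ∑ (λ a → k * f a) ≡⟨ ∑-*ˡ k f ⟩
    k * ∑ f           ≡⟨ ℤ.*-comm k (∑ f) ⟩
    ∑ f * k           ∎

  ∑-additive : Additive A
  ∑-additive = record { apply = ∑ ; apply-+ = ∑-+ ; apply-0 = ∑-0 }

  ∑-δ : (_≟_ : DecidableEquality A) (a : A) → ∑ (λ x → 𝟙 (a ≟ x)) ≡ 1ℤ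
  ∑-δ _≟_ a = trans (∑-single a _ (λ x x≢a → 𝟙-no (a ≟ x) (x≢a ∘ sym))) (𝟙-yes (a ≟ a) refl)

module _ {A B : Set} {{_ : Summable A}} {{_ : Summable B}} where

  ∑-swap : (F : A → B → ℤ) → ∑ (λ a → ∑ (λ b → F a b)) ≡ ∑ (λ b → ∑ (λ a → F a b))
  ∑-swap = ∑-comm ∑-additive

  ∑∑-comm : ∀ {X} (L : Additive X) (F : A → B → X → ℤ) →
            ∑ (λ a → ∑ (λ b → apply L (F a b))) ≡ apply L (λ x → ∑ (λ a → ∑ (λ b → F a b x)))
  ∑∑-comm L F = trans (∑-cong (λ a → ∑-comm L (F a))) (∑-comm L (λ a x → ∑ (λ b → F a b x)))

  ∑∑-single : ∀ a b (f : A → B → ℤ) → (∀ x y → ¬ (x ≡ a × y ≡ b) → f x y ≡ 0ℤ) →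
              ∑ (λ x → ∑ (λ y → f x y)) ≡ f a b
  ∑∑-single a b f off = trans (∑-single a _ off-row) (∑-single b (f a) (λ y y≢b → off a y (y≢b ∘ proj₂)))
    where
    off-row : ∀ x → x ≢ a → ∑ (f x) ≡ 0ℤ
    off-row x x≢a = trans (∑-cong (λ y → off x y (x≢a ∘ proj₁))) (∑-0 {B})

sum-comm : ∀ {k X} (L : Additive X) (F : Fin k → X → ℤ) →
           sum (λ i → apply L (F i)) ≡ apply L (λ x → sum (λ i → F i x))
sum-comm {zero}  L F = sym (apply-0 L)
sum-comm {suc k} L F = begin
  apply L (F zero) + sum (λ i → apply L (F (suc i)))
    ≡⟨ cong (_+_ (apply L (F zero))) (sum-comm L (F ∘ suc)) ⟩
  apply L (F zero) + apply L (λ x → sum (λ i → F (suc i) x))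
    ≡⟨ apply-+ L (F zero) _ ⟨
  apply L (λ x → F zero x + sum (λ i → F (suc i) x)) ∎

sum-single : ∀ {k} (i : Fin k) f → (∀ j → j ≢ i → f j ≡ 0ℤ) → sum f ≡ f i
sum-single {suc k} zero f off = begin
  f zero + sum (f ∘ suc)      ≡⟨ cong (_+_ (f zero)) (sum-cong-≗ (λ j → off (suc j) λ ())) ⟩
  f zero + sum {k} (λ _ → 0ℤ) ≡⟨ cong (_+_ (f zero)) (sum-replicate-zero k) ⟩
  f zero + 0ℤ                 ≡⟨ ℤ.+-identityʳ (f zero) ⟩
  f zero                      ∎
sum-single {suc k} (suc i) f off = begin
  f zero + sum (f ∘ suc) ≡⟨ cong₂ _+_ (off zero λ ())
                                      (sum-single i (f ∘ suc) (λ j j≢i → off (suc j) (j≢i ∘ Fin.suc-injective))) ⟩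
  0ℤ + f (suc i)         ≡⟨ ℤ.+-identityˡ (f (suc i)) ⟩
  f (suc i)              ∎

instance
  summable-Fin : ∀ {k} → Summable (Fin k)
  summable-Fin = record { ∑ = sum ; ∑-cong = sum-cong-≗ ; ∑-comm = sum-comm ; ∑-single = sum-single }

  summable-Bool : Summable Bool
  summable-Bool = record
    { ∑        = λ f → f false + f true
    ; ∑-cong   = λ e → cong₂ _+_ (e false) (e true)
    ; ∑-comm   = λ L F → sym (apply-+ L (F false) (F true))
    ; ∑-single = single }
    where
    single : ∀ a f → (∀ x → x ≢ a → f x ≡ 0ℤ) → f false + f true ≡ f a
    single false f off = trans (cong (_+_ (f false)) (off true λ ())) (ℤ.+-identityʳ (f false))
    single true  f off = trans (cong (_+ f true) (off false λ ())) (ℤ.+-identityˡ (f true))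

  summable-× : {A B : Set} {{_ : Summable A}} {{_ : Summable B}} → Summable (A × B)
  summable-× = record
    { ∑        = λ f → ∑ (λ a → ∑ (λ b → f (a , b)))
    ; ∑-cong   = λ e → ∑-cong (λ a → ∑-cong (λ b → e (a , b)))
    ; ∑-comm   = λ L F → ∑∑-comm L (λ a b → F (a , b))
    ; ∑-single = λ { (a , b) f off → ∑∑-single a b (λ x y → f (x , y))
                                       (λ x y ¬eq → off (x , y) (¬eq ∘ ,-injective)) } }

  summable-Vec : {A : Set} {{_ : Summable A}} {n : ℕ} → Summable (Vec A n)
  summable-Vec {n = zero} = record
    { ∑ = λ f → f [] ; ∑-cong = λ e → e [] ; ∑-comm = λ L F → refl ; ∑-single = λ { [] f _ → refl } }
  summable-Vec {n = suc n} = record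
    { ∑        = λ f → ∑ (λ a → ∑ (λ g → f (a ∷ g)))
    ; ∑-cong   = λ e → ∑-cong (λ a → ∑-cong (λ g → e (a ∷ g)))
    ; ∑-comm   = λ L F → ∑∑-comm L (λ a g → F (a ∷ g))
    ; ∑-single = λ { (a ∷ g) f off → ∑∑-single a g (λ x y → f (x ∷ y))
                                       (λ x y ¬eq → off (x ∷ y) (¬eq ∘ ∷-injective)) } }

∑-1 : ∀ k → ∑ (λ (_ : Fin k) → 1ℤ) ≡ + k
∑-1 zero    = refl
∑-1 (suc k) = cong (_+_ 1ℤ) (∑-1 k)

sumUpTo-cong : ∀ T {f g : ℕ → ℤ} → (∀ i → f i ≡ g i) → sumUpTo T f ≡ sumUpTo T g
sumUpTo-cong zero    e = e zero
sumUpTo-cong (suc T) e = cong₂ _+_ (sumUpTo-cong T e) (e (suc T))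

sumUpTo-∑ : {A : Set} {{_ : Summable A}} (T : ℕ) (F : ℕ → A → ℤ) →
            sumUpTo T (λ i → ∑ (F i)) ≡ ∑ (λ x → sumUpTo T (λ i → F i x))
sumUpTo-∑ zero    F = refl
sumUpTo-∑ (suc T) F = trans (cong (_+ ∑ (F (suc T))) (sumUpTo-∑ T F))
                            (sym (∑-+ (λ x → sumUpTo T (λ i → F i x)) (F (suc T))))

sumUpTo-zero : ∀ T (f : ℕ → ℤ) → (∀ i → i ℕ.≤ T → f i ≡ 0ℤ) → sumUpTo T f ≡ 0ℤ
sumUpTo-zero zero    f off = off zero ℕ.z≤n
sumUpTo-zero (suc T) f off = cong₂ _+_ (sumUpTo-zero T f (λ i i≤T → off i (ℕ.m≤n⇒m≤1+n i≤T)))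
                                       (off (suc T) ℕ.≤-refl)

sumUpTo-single : ∀ {a} T (f : ℕ → ℤ) → a ℕ.≤ T → (∀ i → i ≢ a → f i ≡ 0ℤ) → sumUpTo T f ≡ f a
sumUpTo-single zero f ℕ.z≤n off = refl
sumUpTo-single {a} (suc T) f a≤1+T off with ℕ.m≤n⇒m<n∨m≡n a≤1+T
... | inj₁ a<1+T = begin
  sumUpTo T f + f (suc T) ≡⟨ cong₂ _+_ (sumUpTo-single T f (ℕ.≤-pred a<1+T) off)
                                       (off (suc T) (ℕ.<⇒≢ a<1+T ∘ sym)) ⟩
  f a + 0ℤ                ≡⟨ ℤ.+-identityʳ (f a) ⟩
  f a                     ∎
... | inj₂ refl = begin
  sumUpTo T f + f (suc T) ≡⟨ cong (_+ f (suc T))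
                                  (sumUpTo-zero T f (λ i i≤T → off i (ℕ.<⇒≢ (ℕ.s≤s i≤T)))) ⟩
  0ℤ + f (suc T)          ≡⟨ ℤ.+-identityˡ (f (suc T)) ⟩
  f (suc T)               ∎

sumUpTo-δ : ∀ {a} T (f : ℕ → ℤ) → a ℕ.≤ T → sumUpTo T (λ i → 𝟙 (a ℕ.≟ i) * f i) ≡ f a
sumUpTo-δ {a} T f a≤T = begin
  sumUpTo T (λ i → 𝟙 (a ℕ.≟ i) * f i)
    ≡⟨ sumUpTo-single T _ a≤T (λ i i≢a → cong (_* f i) (𝟙-no (a ℕ.≟ i) (i≢a ∘ sym))) ⟩
  𝟙 (a ℕ.≟ a) * f a
    ≡⟨ cong (_* f a) (𝟙-yes (a ℕ.≟ a) refl) ⟩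
  1ℤ * f a
    ≡⟨ ℤ.*-identityˡ (f a) ⟩
  f a ∎

-- Counting

card≡∑𝟙 : {A : Set} {{_ : Summable A}} {P : Pred A 0ℓ} (P? : Decidable P) →
          ∀ {d} → HasCard (Refinement A P) d → + d ≡ ∑ (λ x → 𝟙 (P? x))
card≡∑𝟙 {A} {P = P} P? {d} enum = begin
  + d                          ≡⟨ ∑-1 d ⟨
  ∑ (λ (k : Fin d) → 1ℤ)       ≡⟨ ∑-cong column ⟨
  ∑ (λ k → ∑ (λ x → hit x k))  ≡⟨ ∑-swap (λ k x → hit x k) ⟩
  ∑ (λ x → ∑ (hit x))          ≡⟨ ∑-cong row ⟩
  ∑ (λ x → 𝟙 (P? x))           ∎
  where
  open Inverse enum
  proof-of : (r : Refinement A P) → P (value r)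
  proof-of (x Ref., [ p ]) = recompute (P? x) p
  hit : A → Fin d → ℤ
  hit x k with P? x
  ... | yes p = 𝟙 (from (x Ref., [ p ]) Fin.≟ k)
  ... | no _  = 0ℤ
  row : ∀ x → ∑ (hit x) ≡ 𝟙 (P? x)
  row x with P? x
  ... | yes p = ∑-δ Fin._≟_ (from (x Ref., [ p ]))
  ... | no _  = ∑-0 {Fin d}
  column : ∀ k → ∑ (λ x → hit x k) ≡ 1ℤ
  column k = trans (∑-single (value (to k)) (λ x → hit x k) off) on
    where
    off : ∀ x → x ≢ value (to k) → hit x k ≡ 0ℤ
    off x x≢ with P? x
    ... | yes p = 𝟙-no (from (x Ref., [ p ]) Fin.≟ k)
                    (λ eq → x≢ (cong value (trans (sym (strictlyInverseˡ _)) (cong to eq))))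
    ... | no _  = refl
    on : hit (value (to k)) k ≡ 1ℤ
    on with P? (value (to k))
    ... | yes p = 𝟙-yes (from (value (to k) Ref., [ p ]) Fin.≟ k)
                    (trans (cong from (value-injective refl)) (strictlyInverseʳ k))
    ... | no ¬p = contradiction (proof-of (to k)) ¬p

count : ∀ {n} → (Fin n → Bool) → ℕ
count {zero}  b = 0
count {suc n} b = if b zero then suc (count (b ∘ suc)) else count (b ∘ suc)

count-card : ∀ {n} {P : Pred (Fin n) 0ℓ} (P? : Decidable P) →
             HasCard (Refinement (Fin n) P) (count (does ∘ P?))
count-card {zero} P? = mk↔ₛ′ (λ ()) (λ { (() Ref., _) }) (λ { (() Ref., _) }) (λ ())
count-card {suc n} {P} P? with P? zero | count-card (P? ∘ suc)
... | yes p₀ | rest = mk↔ₛ′ to from to∘from from∘to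
  where
  module R = Inverse rest
  to : Fin (suc (count (does ∘ P? ∘ suc))) → Refinement (Fin (suc n)) P
  to zero    = zero Ref., [ p₀ ]
  to (suc k) = Ref.map suc id (R.to k)
  from : Refinement (Fin (suc n)) P → Fin (suc (count (does ∘ P? ∘ suc)))
  from (zero  Ref., _) = zero
  from (suc v Ref., p) = suc (R.from (v Ref., p))
  to∘from : ∀ r → to (from r) ≡ r
  to∘from (zero  Ref., _) = refl
  to∘from (suc v Ref., p) = cong (Ref.map suc id) (R.strictlyInverseˡ (v Ref., p))
  from∘to : ∀ k → from (to k) ≡ k
  from∘to zero    = refl
  from∘to (suc k) = cong suc (R.strictlyInverseʳ k)
... | no ¬p₀ | rest = mk↔ₛ′ to from to∘from R.strictlyInverseʳ
  where
  module R = Inverse rest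
  to : Fin (count (does ∘ P? ∘ suc)) → Refinement (Fin (suc n)) P
  to k = Ref.map suc id (R.to k)
  from : Refinement (Fin (suc n)) P → Fin (count (does ∘ P? ∘ suc))
  from (zero  Ref., [ p ]) = contradiction (recompute (P? zero) p) ¬p₀
  from (suc v Ref., p)     = R.from (v Ref., p)
  to∘from : ∀ r → to (from r) ≡ r
  to∘from (zero  Ref., [ p ]) = contradiction (recompute (P? zero) p) ¬p₀
  to∘from (suc v Ref., p)     = cong (Ref.map suc id) (R.strictlyInverseˡ (v Ref., p))

count-≤ : ∀ {n} (b : Fin n → Bool) → count b ℕ.≤ n
count-≤ {zero}  b = ℕ.z≤n
count-≤ {suc n} b with b zero
... | true  = ℕ.s≤s (count-≤ (b ∘ suc))
... | false = ℕ.m≤n⇒m≤1+n (count-≤ (b ∘ suc))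

count-cong : ∀ {n} {b b′ : Fin n → Bool} → (∀ v → b v ≡ b′ v) → count b ≡ count b′
count-cong {zero}  e = refl
count-cong {suc n} {b} {b′} e with b zero | b′ zero | e zero
... | true  | _ | refl = cong suc (count-cong (e ∘ suc))
... | false | _ | refl = count-cong (e ∘ suc)

count-remove : ∀ {n} (b : Fin n → Bool) (r : Fin n) → b r ≡ true →
               count b ≡ suc (count (λ v → b v ∧ not (does (v Fin.≟ r))))
count-remove {suc n} b zero br rewrite br = cong suc (count-cong (λ v → sym (∧-identityʳ (b (suc v)))))
count-remove {suc n} b (suc r) br with b zero
... | true  = cong suc (count-remove (b ∘ suc) r br)
... | false = count-remove (b ∘ suc) r br

^-count : ∀ {n} (a : ℤ) (b : Fin n → Bool) → a ^ count b ≡ ∏ (λ v → if b v then a else 1ℤ)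
^-count {zero}  a b = refl
^-count {suc n} a b with b zero
... | true  = cong (a *_) (^-count a (b ∘ suc))
... | false = trans (^-count a (b ∘ suc)) (sym (ℤ.*-identityˡ _))

∏-𝟙 : ∀ {n} {P : Pred (Fin n) 0ℓ} (P? : Decidable P) → ∏ (λ v → 𝟙 (P? v)) ≡ 𝟙 (all? P?)
∏-𝟙 {zero}  P? = refl
∏-𝟙 {suc n} P? = trans (cong (𝟙 (P? zero) *_) (∏-𝟙 (P? ∘ suc))) (sym (𝟙-× (P? zero) (all? (P? ∘ suc))))

∏-single : ∀ {n} (r : Fin n) (x : ℤ) → ∏ (λ v → if does (v Fin.≟ r) then x else 1ℤ) ≡ x
∏-single {suc n} zero    x = trans (cong (x *_) (∏-1 n)) (ℤ.*-identityʳ x)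
∏-single {suc n} (suc r) x = trans (ℤ.*-identityˡ _) (∏-single r x)

∏-one-minus-expansion : ∀ {k} (t : Fin k → ℤ) →
  ∑ (λ s → sign ∣ s ∣ * ∏ (λ e → if lookup s e then t e else 1ℤ)) ≡ ∏ (λ e → 1ℤ + - t e)
∏-one-minus-expansion {zero}  t = refl
∏-one-minus-expansion {suc k} t = begin
  ∑ (λ s → sign ∣ s ∣ * (1ℤ * ∏ (t∈ s))) + ∑ (λ s → - sign ∣ s ∣ * (t zero * ∏ (t∈ s)))
    ≡⟨ cong₂ _+_ (∑-cong (λ s → cong (sign ∣ s ∣ *_) (ℤ.*-identityˡ (∏ (t∈ s)))))
                 (∑-cong (λ s → move-sign (sign ∣ s ∣) (t zero) (∏ (t∈ s)))) ⟩
  Z + ∑ (λ s → - t zero * (sign ∣ s ∣ * ∏ (t∈ s)))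
    ≡⟨ cong (_+_ Z) (∑-*ˡ (- t zero) (λ s → sign ∣ s ∣ * ∏ (t∈ s))) ⟩
  Z + - t zero * Z
    ≡⟨ factor-out Z (t zero) ⟩
  (1ℤ + - t zero) * Z
    ≡⟨ cong ((1ℤ + - t zero) *_) (∏-one-minus-expansion (t ∘ suc)) ⟩
  (1ℤ + - t zero) * ∏ (λ e → 1ℤ + - t (suc e)) ∎
  where
  t∈ : Subset k → Fin k → ℤ
  t∈ s e = if lookup s e then t (suc e) else 1ℤ
  Z = ∑ (λ s → sign ∣ s ∣ * ∏ (t∈ s))
  move-sign : ∀ a x y → - a * (x * y) ≡ - x * (a * y)
  move-sign = solve-∀
  factor-out : ∀ z x → z + - x * z ≡ (1ℤ + - x) * z
  factor-out = solve-∀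

-- Unlike Data.Fin.Subset.Properties._∈?_, does (member? v c) is lookup c v by definition.
member? : ∀ {n} (v : Fin n) (c : Subset n) → Dec (v ∈ c)
member? v c = map′ (lookup⇒[]= v c ∘ Equivalence.to T-≡) (Equivalence.from T-≡ ∘ []=⇒lookup) (T? (lookup c v))

-- Products with copied coordinates

data Factor (A : Set) (n : ℕ) : Set where
  free : (A → ℤ) → Factor A n
  copy : Fin n → Factor A n

module _ {A : Set} {{_ : Summable A}} (_≟_ : DecidableEquality A) where

  weight : ∀ {n} → Factor A n → Vec A n → Fin n → ℤ
  weight (free φ) g v = φ (lookup g v)
  weight (copy u) g v = 𝟙 (lookup g u ≟ lookup g v)

  mass : ∀ {n} → Factor A n → ℤ
  mass (free φ) = ∑ φ
  mass (copy _) = 1ℤ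

  CopiesEarlier : ∀ {n} → (Fin n → Factor A n) → Set
  CopiesEarlier F = ∀ {u v} → F v ≡ copy u → u Fin.< v

  private
    fix-first : ∀ {n} → A → Factor A (suc n) → Factor A n
    fix-first a (free φ)       = free φ
    fix-first a (copy zero)    = free (λ b → 𝟙 (a ≟ b))
    fix-first a (copy (suc u)) = copy u

    weight-fix-first : ∀ {n} a g v (F : Factor A (suc n)) → weight F (a ∷ g) (suc v) ≡ weight (fix-first a F) g v
    weight-fix-first a g v (free φ)       = refl
    weight-fix-first a g v (copy zero)    = refl
    weight-fix-first a g v (copy (suc u)) = refl

    mass-fix-first : ∀ {n} a (F : Factor A (suc n)) → mass (fix-first a F) ≡ mass F
    mass-fix-first a (free φ)       = refl
    mass-fix-first a (copy zero)    = ∑-δ _≟_ a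
    mass-fix-first a (copy (suc u)) = refl

    fix-first-copy : ∀ {n} a (F : Factor A (suc n)) {u} → fix-first a F ≡ copy u → F ≡ copy (suc u)
    fix-first-copy a (copy (suc u)) refl = refl

  -- Summing out the first coordinate a turns its copies into the free weight 𝟙 (a ≟_), of mass 1.
  ∑∏-weight≡∏-mass : ∀ {n} (F : Fin n → Factor A n) → CopiesEarlier F →
                     ∑ (λ g → ∏ (λ v → weight (F v) g v)) ≡ ∏ (λ v → mass (F v))
  ∑∏-weight≡∏-mass {zero}  F earlier = refl
  ∑∏-weight≡∏-mass {suc n} F earlier with F zero in F₀≡
  ... | copy u = contradiction (earlier F₀≡) λ ()
  ... | free φ = begin
    ∑ (λ a → ∑ (λ g → φ a * ∏ (λ v → weight (F (suc v)) (a ∷ g) (suc v))))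
      ≡⟨ ∑-cong (λ a → ∑-cong (λ g → cong (φ a *_)
                                          (∏-cong (λ v → weight-fix-first a g v (F (suc v)))))) ⟩
    ∑ (λ a → ∑ (λ g → φ a * ∏ (λ v → weight (F′ a v) g v)))
      ≡⟨ ∑-cong (λ a → ∑-*ˡ (φ a) (λ g → ∏ (λ v → weight (F′ a v) g v))) ⟩
    ∑ (λ a → φ a * ∑ (λ g → ∏ (λ v → weight (F′ a v) g v)))
      ≡⟨ ∑-cong (λ a → cong (φ a *_) (trans (∑∏-weight≡∏-mass (F′ a) (earlier′ a))
                                            (∏-cong (λ v → mass-fix-first a (F (suc v)))))) ⟩
    ∑ (λ a → φ a * ∏ (λ v → mass (F (suc v))))
      ≡⟨ ∑-*ʳ _ φ ⟩
    ∑ φ * ∏ (λ v → mass (F (suc v))) ∎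
    where
    F′ : A → Fin n → Factor A n
    F′ a v = fix-first a (F (suc v))
    earlier′ : ∀ a → CopiesEarlier (F′ a)
    earlier′ a {v = v} F′≡ = ℕ.≤-pred (earlier (fix-first-copy a (F (suc v)) F′≡))

-- Connected components

Joins : ∀ {n} → Fin n × Fin n → Fin n → Fin n → Set
Joins p u v = (proj₁ p ≡ u × proj₂ p ≡ v) ⊎ (proj₁ p ≡ v × proj₂ p ≡ u)

Joins-sym : ∀ {n} {p : Fin n × Fin n} {u v} → Joins p u v → Joins p v u
Joins-sym (inj₁ (a , b)) = inj₂ (a , b)
Joins-sym (inj₂ (a , b)) = inj₁ (a , b)

Along : ∀ {n k} → (Fin k → Fin n × Fin n) → Pred (Fin k) 0ℓ → Rel (Fin n) 0ℓ
Along ends P u v = ∃ λ e → P e × Joins (ends e) u v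

Along-sym : ∀ {n k} {ends : Fin k → Fin n × Fin n} {P} → Symmetric (Along ends P)
Along-sym (e , p , j) = e , p , Joins-sym j

Star-cong : ∀ {n} {R S : Rel (Fin n) 0ℓ} → (∀ {u v} → R u v ⇔ S u v) → ∀ {u v} → Star R u v ⇔ Star S u v
Star-cong R⇔S = mk⇔ (Star.map (Equivalence.to R⇔S)) (Star.map (Equivalence.from R⇔S))

module _ {n} {R : Rel (Fin n) 0ℓ} (R-sym : Symmetric R) (a b : Fin n) where

  Through : Fin n → Fin n → Set
  Through u v = Star R u v ⊎ (Star R u a × Star R b v) ⊎ (Star R u b × Star R a v)

  Star-∪-edge : ∀ {u v} → Star (λ x y → R x y ⊎ Joins (a , b) x y) u v ⇔ Through u v
  Star-∪-edge = mk⇔ split join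
    where
    back : ∀ {u v} → Star R u v → Star R v u
    back = Star.reverse R-sym
    split : ∀ {u v} → Star (λ x y → R x y ⊎ Joins (a , b) x y) u v → Through u v
    split ε = inj₁ ε
    split (inj₁ r ◅ rest) with split rest
    ... | inj₁ p              = inj₁ (r ◅ p)
    ... | inj₂ (inj₁ (p , q)) = inj₂ (inj₁ (r ◅ p , q))
    ... | inj₂ (inj₂ (p , q)) = inj₂ (inj₂ (r ◅ p , q))
    split (inj₂ (inj₁ (refl , refl)) ◅ rest) with split rest
    ... | inj₁ p              = inj₂ (inj₁ (ε , p))
    ... | inj₂ (inj₁ (p , q)) = inj₁ (back p ◅◅ q)
    ... | inj₂ (inj₂ (_ , q)) = inj₁ q
    split (inj₂ (inj₂ (refl , refl)) ◅ rest) with split rest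
    ... | inj₁ p              = inj₂ (inj₂ (ε , p))
    ... | inj₂ (inj₁ (_ , q)) = inj₁ q
    ... | inj₂ (inj₂ (p , q)) = inj₁ (back p ◅◅ q)
    lift : ∀ {u v} → Star R u v → Star (λ x y → R x y ⊎ Joins (a , b) x y) u v
    lift = Star.map inj₁
    join : ∀ {u v} → Through u v → Star (λ x y → R x y ⊎ Joins (a , b) x y) u v
    join (inj₁ p)              = lift p
    join (inj₂ (inj₁ (p , q))) = lift p ◅◅ (inj₂ (inj₁ (refl , refl)) ◅ lift q)
    join (inj₂ (inj₂ (p , q))) = lift p ◅◅ (inj₂ (inj₂ (refl , refl)) ◅ lift q)

connected? : ∀ {n k} (ends : Fin k → Fin n × Fin n) {P : Pred (Fin k) 0ℓ} → Decidable P →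
             Decidable₂ (Star (Along ends P))
connected? {k = zero} ends P? u v =
  Dec.map (mk⇔ (λ { refl → ε }) λ { ε → refl ; ((() , _) ◅ _) }) (u Fin.≟ v)
connected? {k = suc k} ends {P} P? u v with P? zero
... | yes p₀ = Dec.map (Star-cong (mk⇔ add-edge drop-edge) ⇔-∘ ⇔-sym (Star-∪-edge Along-sym a b))
                       (R? u v ⊎-dec (R? u a ×-dec R? b v) ⊎-dec (R? u b ×-dec R? a v))
  where
  R? = connected? (ends ∘ suc) (P? ∘ suc)
  a = proj₁ (ends zero)
  b = proj₂ (ends zero)
  add-edge : ∀ {u v} → Along (ends ∘ suc) (P ∘ suc) u v ⊎ Joins (a , b) u v → Along ends P u v
  add-edge (inj₁ (e , p , j)) = suc e , p , j
  add-edge (inj₂ j)           = zero , p₀ , j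
  drop-edge : ∀ {u v} → Along ends P u v → Along (ends ∘ suc) (P ∘ suc) u v ⊎ Joins (a , b) u v
  drop-edge (zero  , _ , j) = inj₂ j
  drop-edge (suc e , p , j) = inj₁ (e , p , j)
... | no ¬p₀ = Dec.map (Star-cong (mk⇔ (λ { (e , p , j) → suc e , p , j }) drop-edge))
                       (connected? (ends ∘ suc) (P? ∘ suc) u v)
  where
  drop-edge : ∀ {u v} → Along ends P u v → Along (ends ∘ suc) (P ∘ suc) u v
  drop-edge (zero  , p , _) = contradiction p ¬p₀
  drop-edge (suc e , p , j) = e , p , j

least : ∀ {n} {P : Pred (Fin n) 0ℓ} → Decidable P → (w : Fin n) → P w →
        ∃ λ u → P u × (∀ {v} → P v → u Fin.≤ v)
least P? zero    p = zero , p , λ _ → ℕ.z≤n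
least P? (suc w) p with P? zero
... | yes p₀ = zero , p₀ , λ _ → ℕ.z≤n
... | no ¬p₀ with least (P? ∘ suc) w p
...   | u , pu , u-min = suc u , pu , λ { {zero} p₀ → contradiction p₀ ¬p₀ ; {suc v} pv → ℕ.s≤s (u-min pv) }

Respects : (Γ : Graph) → Subset (m Γ) → {B : Set} → (Fin (n Γ) → B) → Set
Respects Γ s h = ∀ u v → Adj Γ s u v → h u ≡ h v

module Components (Γ : Graph) (s : Subset (m Γ)) where

  V = Fin (n Γ)

  sameComp? : Decidable₂ (SameComp Γ s)
  sameComp? = connected? (edge Γ) (λ e → member? e s)

  rep : V → V
  rep v = proj₁ (least (λ u → sameComp? u v) v ε)

  rep-sameComp : ∀ v → SameComp Γ s (rep v) v
  rep-sameComp v = proj₁ (proj₂ (least (λ u → sameComp? u v) v ε))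

  rep-least : ∀ {u v} → SameComp Γ s u v → rep v Fin.≤ u
  rep-least {u} {v} = proj₂ (proj₂ (least (λ u → sameComp? u v) v ε))

  rep-cong : ∀ {u v} → SameComp Γ s u v → rep u ≡ rep v
  rep-cong u~v = Fin.≤-antisym (rep-least (rep-sameComp _ ◅◅ Star.reverse Along-sym u~v))
                               (rep-least (rep-sameComp _ ◅◅ u~v))

  rep-< : ∀ {v} → rep v ≢ v → rep v Fin.< v
  rep-< = Fin.≤∧≢⇒< (rep-least ε)

  IsLeast : V → Set
  IsLeast v = ∀ u → SameComp Γ s u v → Fin.toℕ v ℕ.≤ Fin.toℕ u

  IsLeast⇔rep≡ : ∀ {v} → IsLeast v ⇔ (rep v ≡ v)
  IsLeast⇔rep≡ {v} = mk⇔ (λ v-least → Fin.≤-antisym (rep-least ε) (v-least _ (rep-sameComp v)))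
                          (λ rv≡v u u~v → subst (Fin._≤ u) rv≡v (rep-least u~v))

  isLeast? : Decidable IsLeast
  isLeast? v = Dec.map (⇔-sym IsLeast⇔rep≡) (rep v Fin.≟ v)

  rep-isLeast : ∀ v → IsLeast (rep v)
  rep-isLeast v = Equivalence.from IsLeast⇔rep≡ (rep-cong (rep-sameComp v))

  module _ {B : Set} (h : V → B) where

    Respects⇔edges : Respects Γ s h ⇔ (∀ e → e ∈ s → h (src Γ e) ≡ h (tgt Γ e))
    Respects⇔edges = mk⇔ (λ resp e e∈s → resp _ _ (e , e∈s , inj₁ (refl , refl))) along
      where
      along : (∀ e → e ∈ s → h (src Γ e) ≡ h (tgt Γ e)) → Respects Γ s h
      along mono u v (e , e∈s , inj₁ (refl , refl)) = mono e e∈s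
      along mono u v (e , e∈s , inj₂ (refl , refl)) = sym (mono e e∈s)

    Respects⇔rep : Respects Γ s h ⇔ (∀ v → h (rep v) ≡ h v)
    Respects⇔rep = mk⇔ (λ resp v → constant resp (rep-sameComp v))
                       (λ at-rep u v u~v → trans (sym (at-rep u)) (trans (cong h (rep-cong (u~v ◅ ε))) (at-rep v)))
      where
      constant : Respects Γ s h → ∀ {u v} → SameComp Γ s u v → h u ≡ h v
      constant resp ε            = refl
      constant resp (u~w ◅ w~v) = trans (resp _ _ u~w) (constant resp w~v)

    respects? : DecidableEquality B → Dec (Respects Γ s h)
    respects? _≟_ = Dec.map (⇔-sym Respects⇔edges) (all? λ e → member? e s →-dec (h (src Γ e) ≟ h (tgt Γ e)))

  whenLeast : V → ℤ → ℤ
  whenLeast v x = if does (isLeast? v) then x else 1ℤ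

  module _ {A : Set} {{_ : Summable A}} (_≟_ : DecidableEquality A) (φ : V → A → ℤ) where

    private
      factor : V → Factor A (n Γ)
      factor v = if does (isLeast? v) then free (φ v) else copy (rep v)

      factor-earlier : CopiesEarlier _≟_ factor
      factor-earlier {u} {v} factor≡ with rep v Fin.≟ v | factor≡
      ... | no rv≢v | refl = rep-< rv≢v

      weight-factor : ∀ g v → 𝟙 (lookup g (rep v) ≟ lookup g v) * whenLeast v (φ v (lookup g v))
                              ≡ weight _≟_ (factor v) g v
      weight-factor g v with rep v Fin.≟ v
      ... | yes rv≡v = trans (cong (_* φ v (lookup g v)) (𝟙-yes (_ ≟ _) (cong (lookup g) rv≡v)))
                             (ℤ.*-identityˡ (φ v (lookup g v)))
      ... | no _     = ℤ.*-identityʳ _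

      mass-factor : ∀ v → mass _≟_ (factor v) ≡ whenLeast v (∑ (φ v))
      mass-factor v with rep v Fin.≟ v
      ... | yes _ = refl
      ... | no _  = refl

      respects≡∏ : ∀ g → 𝟙 (respects? (lookup g) _≟_) ≡ ∏ (λ v → 𝟙 (lookup g (rep v) ≟ lookup g v))
      respects≡∏ g = trans (𝟙-cong (Respects⇔rep (lookup g)) (respects? (lookup g) _≟_)
                                   (all? (λ v → lookup g (rep v) ≟ lookup g v)))
                           (sym (∏-𝟙 (λ v → lookup g (rep v) ≟ lookup g v)))

    ∑-respecting : ∑ (λ g → 𝟙 (respects? (lookup g) _≟_) * ∏ (λ v → whenLeast v (φ v (lookup g v))))
                   ≡ ∏ (λ v → whenLeast v (∑ (φ v)))
    ∑-respecting = begin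
      ∑ (λ g → 𝟙 (respects? (lookup g) _≟_) * ∏ (λ v → whenLeast v (φ v (lookup g v))))
        ≡⟨ ∑-cong (λ g → cong (_* ∏ (λ v → whenLeast v (φ v (lookup g v)))) (respects≡∏ g)) ⟩
      ∑ (λ g → ∏ (λ v → 𝟙 (lookup g (rep v) ≟ lookup g v)) * ∏ (λ v → whenLeast v (φ v (lookup g v))))
        ≡⟨ ∑-cong (λ g → sym (∏-distrib (λ v → 𝟙 (lookup g (rep v) ≟ lookup g v))
                                         (λ v → whenLeast v (φ v (lookup g v))))) ⟩
      ∑ (λ g → ∏ (λ v → 𝟙 (lookup g (rep v) ≟ lookup g v) * whenLeast v (φ v (lookup g v))))
        ≡⟨ ∑-cong (λ g → ∏-cong (weight-factor g)) ⟩
      ∑ (λ g → ∏ (λ v → weight _≟_ (factor v) g v))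
        ≡⟨ ∑∏-weight≡∏-mass _≟_ factor factor-earlier ⟩
      ∏ (λ v → mass _≟_ (factor v))
        ≡⟨ ∏-cong mass-factor ⟩
      ∏ (λ v → whenLeast v (∑ (φ v))) ∎

  ∑-respecting-colourings : ∀ k → ∑ (λ (g : Vec (Fin k) (n Γ)) → 𝟙 (respects? (lookup g) Fin._≟_))
                                   ≡ (+ k) ^ count (does ∘ isLeast?)
  ∑-respecting-colourings k = begin
    ∑ (λ g → 𝟙 (respects? (lookup g) Fin._≟_))
      ≡⟨ ∑-cong (λ g → trans (sym (ℤ.*-identityʳ _))
                             (cong (𝟙 (respects? (lookup g) Fin._≟_) *_)
                                   (sym (trans (∏-cong (λ v → if-eta (does (isLeast? v)))) (∏-1 (n Γ)))))) ⟩
    ∑ (λ g → 𝟙 (respects? (lookup g) Fin._≟_) * ∏ (λ v → whenLeast v 1ℤ))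
      ≡⟨ ∑-respecting Fin._≟_ (λ _ _ → 1ℤ) ⟩
    ∏ (λ v → whenLeast v (∑ (λ (_ : Fin k) → 1ℤ)))
      ≡⟨ ∏-cong (λ v → cong (whenLeast v) (∑-1 k)) ⟩
    ∏ (λ v → whenLeast v (+ k))
      ≡⟨ ^-count (+ k) (does ∘ isLeast?) ⟨
    (+ k) ^ count (does ∘ isLeast?) ∎

-- Reduced states

module BaseComponent (Γ : Graph) (v₀ : Fin (n Γ)) (s : Subset (m Γ)) where

  open Components Γ s

  r₀ : V
  r₀ = rep v₀

  Valid : Subset (n Γ) → Set
  Valid c = RespectsComps Γ s c × v₀ ∈ c

  valid? : Decidable Valid
  valid? c = respects? (lookup c) Bool._≟_ ×-dec member? v₀ c

  IsXRoot : Subset (n Γ) → V → Set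
  IsXRoot c v = v ∈ c × IsLeast v

  isXRoot? : ∀ c → Decidable (IsXRoot c)
  isXRoot? c v = member? v c ×-dec isLeast? v

  degree : Subset (n Γ) → ℕ
  degree c = count (λ v → does (isXRoot? c v) ∧ not (does (v Fin.≟ r₀)))

  r₀-isXRoot : ∀ {c} → Valid c → IsXRoot c r₀
  r₀-isXRoot {c} (resp , v₀∈c) =
    lookup⇒[]= r₀ c (trans (Equivalence.to (Respects⇔rep (lookup c)) resp v₀) ([]=⇒lookup v₀∈c)) ,
    rep-isLeast v₀

  xComp-card : ∀ {c} → Valid c → HasCard (XComp Γ s c) (suc (degree c))
  xComp-card {c} valid = subst (HasCard (XComp Γ s c))
    (count-remove (does ∘ isXRoot? c) r₀ (dec-true (isXRoot? c r₀) (r₀-isXRoot valid)))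
    (count-card (isXRoot? c))

  module _ (q : ℕ) where

    -- The base component is forced to be coloured x and does not count towards the degree.
    xWeight : V → Bool → ℤ
    xWeight v b = if does (v Fin.≟ r₀) then (if b then 1ℤ else 0ℤ) else (if b then + q else 1ℤ)

    private
      root-factor : ∀ c v → whenLeast v (xWeight v (lookup c v))
                            ≡ (if does (v Fin.≟ r₀) then 𝟙 (member? r₀ c) else 1ℤ)
                              * (if does (isXRoot? c v) ∧ not (does (v Fin.≟ r₀)) then + q else 1ℤ)
      root-factor c v with v Fin.≟ r₀
      ... | yes refl with rep r₀ Fin.≟ r₀ | lookup c r₀
      ...   | yes _ | true  = refl
      ...   | yes _ | false = refl
      ...   | no r₀-not-least | _ = contradiction (rep-cong (rep-sameComp v₀)) r₀-not-least
      root-factor c v | no _ with rep v Fin.≟ v | lookup c v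
      ...   | yes _ | true  = sym (ℤ.*-identityˡ (+ q))
      ...   | yes _ | false = refl
      ...   | no _  | true  = refl
      ...   | no _  | false = refl

      mass-xWeight : ∀ v → whenLeast v (∑ (xWeight v))
                           ≡ (if does (isLeast? v) ∧ not (does (v Fin.≟ r₀)) then + suc q else 1ℤ)
      mass-xWeight v with rep v Fin.≟ v | v Fin.≟ r₀
      ... | yes _ | yes _ = refl
      ... | yes _ | no _  = refl
      ... | no _  | _     = refl

      valid-weight : ∀ c → 𝟙 (valid? c) * (+ q) ^ degree c
                           ≡ 𝟙 (respects? (lookup c) Bool._≟_) * ∏ (λ v → whenLeast v (xWeight v (lookup c v)))
      valid-weight c = begin
        𝟙 (valid? c) * (+ q) ^ degree c
          ≡⟨ cong (_* (+ q) ^ degree c) (𝟙-× resp? (member? v₀ c)) ⟩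
        𝟙 resp? * 𝟙 (member? v₀ c) * (+ q) ^ degree c
          ≡⟨ ℤ.*-assoc (𝟙 resp?) _ _ ⟩
        𝟙 resp? * (𝟙 (member? v₀ c) * (+ q) ^ degree c)
          ≡⟨ 𝟙-*-cong resp? (λ resp → cong (λ b → (if b then 1ℤ else 0ℤ) * (+ q) ^ degree c)
                                           (sym (Equivalence.to (Respects⇔rep (lookup c)) resp v₀))) ⟩
        𝟙 resp? * (𝟙 (member? r₀ c) * (+ q) ^ degree c)
          ≡⟨ cong (𝟙 resp? *_) (cong₂ _*_ (sym (∏-single r₀ (𝟙 (member? r₀ c)))) (^-count (+ q) deg-root)) ⟩
        𝟙 resp? * (∏ at-r₀ * ∏ (λ v → if deg-root v then + q else 1ℤ))
          ≡⟨ cong (𝟙 resp? *_) (sym (∏-distrib at-r₀ (λ v → if deg-root v then + q else 1ℤ))) ⟩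
        𝟙 resp? * ∏ (λ v → at-r₀ v * (if deg-root v then + q else 1ℤ))
          ≡⟨ cong (𝟙 resp? *_) (∏-cong (λ v → sym (root-factor c v))) ⟩
        𝟙 resp? * ∏ (λ v → whenLeast v (xWeight v (lookup c v))) ∎
        where
        resp? = respects? (lookup c) Bool._≟_
        deg-root : V → Bool
        deg-root v = does (isXRoot? c v) ∧ not (does (v Fin.≟ r₀))
        at-r₀ : V → ℤ
        at-r₀ v = if does (v Fin.≟ r₀) then 𝟙 (member? r₀ c) else 1ℤ

    ∑-valid : ∑ (λ c → 𝟙 (valid? c) * (+ q) ^ degree c)
              ≡ (+ suc q) ^ count (λ v → does (isLeast? v) ∧ not (does (v Fin.≟ r₀)))
    ∑-valid = begin
      ∑ (λ c → 𝟙 (valid? c) * (+ q) ^ degree c)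
        ≡⟨ ∑-cong valid-weight ⟩
      ∑ (λ c → 𝟙 (respects? (lookup c) Bool._≟_) * ∏ (λ v → whenLeast v (xWeight v (lookup c v))))
        ≡⟨ ∑-respecting Bool._≟_ xWeight ⟩
      ∏ (λ v → whenLeast v (∑ (xWeight v)))
        ≡⟨ ∏-cong mass-xWeight ⟩
      ∏ (λ v → if does (isLeast? v) ∧ not (does (v Fin.≟ r₀)) then + suc q else 1ℤ)
        ≡⟨ ^-count (+ suc q) (λ v → does (isLeast? v) ∧ not (does (v Fin.≟ r₀))) ⟨
      (+ suc q) ^ count (λ v → does (isLeast? v) ∧ not (does (v Fin.≟ r₀))) ∎

    ∑-valid≡∑-respecting : + suc q * ∑ (λ c → 𝟙 (valid? c) * (+ q) ^ degree c)
                           ≡ ∑ (λ (g : Vec (Fin (suc q)) (n Γ)) → 𝟙 (respects? (lookup g) Fin._≟_))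
    ∑-valid≡∑-respecting = begin
      + suc q * ∑ (λ c → 𝟙 (valid? c) * (+ q) ^ degree c)
        ≡⟨ cong (+ suc q *_) ∑-valid ⟩
      (+ suc q) ^ suc (count (λ v → does (isLeast? v) ∧ not (does (v Fin.≟ r₀))))
        ≡⟨ cong ((+ suc q) ^_) (count-remove (does ∘ isLeast?) r₀ (dec-true (isLeast? r₀) (rep-isLeast v₀))) ⟨
      (+ suc q) ^ count (does ∘ isLeast?)
        ≡⟨ ∑-respecting-colourings (suc q) ⟨
      ∑ (λ g → 𝟙 (respects? (lookup g) Fin._≟_)) ∎

module StateSums (Γ : Graph) (v₀ : Fin (n Γ)) where

  open BaseComponent Γ v₀

  IsState : ℕ → ℕ → Pred (Subset (m Γ) × Subset (n Γ)) 0ℓ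
  IsState i j (s , c) = RespectsComps Γ s c × v₀ ∈ c × ∣ s ∣ ≡ i × HasCard (XComp Γ s c) (suc j)

  IsState⇔ : ∀ i j s c → IsState i j (s , c) ⇔ (Valid s c × ∣ s ∣ ≡ i × degree s c ≡ j)
  IsState⇔ i j s c = mk⇔
    (λ (resp , v₀∈c , size , card) →
       (resp , v₀∈c) , size , ℕ.suc-injective (↔⇒≡ (↔-sym card ↔-∘ xComp-card s (resp , v₀∈c))))
    (λ { (valid , size , refl) → proj₁ valid , proj₂ valid , size , xComp-card s valid })

  state? : ∀ i j → Decidable (IsState i j)
  state? i j (s , c) = Dec.map (⇔-sym (IsState⇔ i j s c))
                               (valid? s c ×-dec (∣ s ∣ ℕ.≟ i ×-dec degree s c ℕ.≟ j))

  module _ (q : ℕ) where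

    ∑-over-degrees : ∀ s c →
      sumUpTo (m Γ) (λ i → sumUpTo (n Γ) (λ j → sign i * (+ q) ^ j * 𝟙 (state? i j (s , c))))
      ≡ sign ∣ s ∣ * (𝟙 (valid? s c) * (+ q) ^ degree s c)
    ∑-over-degrees s c = begin
      sumUpTo (m Γ) (λ i → sumUpTo (n Γ) (λ j → sign i * (+ q) ^ j * 𝟙 (state? i j (s , c))))
        ≡⟨ sumUpTo-cong (m Γ) (λ i → sumUpTo-cong (n Γ) (λ j → separate i j)) ⟩
      sumUpTo (m Γ) (λ i → sumUpTo (n Γ) (λ j →
        𝟙 (degree s c ℕ.≟ j) * (𝟙 (∣ s ∣ ℕ.≟ i) * (sign i * (+ q) ^ j * V))))
        ≡⟨ sumUpTo-cong (m Γ) (λ i → sumUpTo-δ (n Γ) _ (count-≤ _)) ⟩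
      sumUpTo (m Γ) (λ i → 𝟙 (∣ s ∣ ℕ.≟ i) * (sign i * (+ q) ^ degree s c * V))
        ≡⟨ sumUpTo-δ (m Γ) _ (∣p∣≤n s) ⟩
      sign ∣ s ∣ * (+ q) ^ degree s c * V
        ≡⟨ reorder (sign ∣ s ∣) ((+ q) ^ degree s c) V ⟩
      sign ∣ s ∣ * (V * (+ q) ^ degree s c) ∎
      where
      V = 𝟙 (valid? s c)
      rearrange : ∀ σ x v a b → σ * x * (v * (a * b)) ≡ b * (a * (σ * x * v))
      rearrange = solve-∀
      reorder : ∀ σ x v → σ * x * v ≡ σ * (v * x)
      reorder = solve-∀
      separate : ∀ i j → sign i * (+ q) ^ j * 𝟙 (state? i j (s , c))
                         ≡ 𝟙 (degree s c ℕ.≟ j) * (𝟙 (∣ s ∣ ℕ.≟ i) * (sign i * (+ q) ^ j * V))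
      separate i j = begin
        sign i * (+ q) ^ j * 𝟙 (valid? s c ×-dec (∣ s ∣ ℕ.≟ i ×-dec degree s c ℕ.≟ j))
          ≡⟨ cong (sign i * (+ q) ^ j *_) (trans (𝟙-× (valid? s c) (∣ s ∣ ℕ.≟ i ×-dec degree s c ℕ.≟ j))
                                                 (cong (V *_) (𝟙-× (∣ s ∣ ℕ.≟ i) (degree s c ℕ.≟ j)))) ⟩
        sign i * (+ q) ^ j * (V * (𝟙 (∣ s ∣ ℕ.≟ i) * 𝟙 (degree s c ℕ.≟ j)))
          ≡⟨ rearrange (sign i) ((+ q) ^ j) V (𝟙 (∣ s ∣ ℕ.≟ i)) (𝟙 (degree s c ℕ.≟ j)) ⟩
        𝟙 (degree s c ℕ.≟ j) * (𝟙 (∣ s ∣ ℕ.≟ i) * (sign i * (+ q) ^ j * V)) ∎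

    eulerChar≡∑-valid : ∀ {dim} → (∀ i j → HasCard (ReducedState Γ v₀ i j) (dim i j)) →
      eulerChar Γ dim (+ q) ≡ ∑ (λ s → sign ∣ s ∣ * ∑ (λ c → 𝟙 (valid? s c) * (+ q) ^ degree s c))
    eulerChar≡∑-valid {dim} card = begin
      sumUpTo (m Γ) (λ i → sumUpTo (n Γ) (λ j → sign i * (+ q) ^ j * + dim i j))
        ≡⟨ sumUpTo-cong (m Γ) (λ i → sumUpTo-cong (n Γ) (λ j →
             trans (cong (sign i * (+ q) ^ j *_) (card≡∑𝟙 (state? i j) (card i j)))
                   (sym (∑-*ˡ (sign i * (+ q) ^ j) (λ x → 𝟙 (state? i j x)))))) ⟩
      sumUpTo (m Γ) (λ i → sumUpTo (n Γ) (λ j → ∑ (λ x → sign i * (+ q) ^ j * 𝟙 (state? i j x))))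
        ≡⟨ sumUpTo-cong (m Γ) (λ i → sumUpTo-∑ (n Γ) (λ j x → sign i * (+ q) ^ j * 𝟙 (state? i j x))) ⟩
      sumUpTo (m Γ) (λ i → ∑ (λ x → sumUpTo (n Γ) (λ j → sign i * (+ q) ^ j * 𝟙 (state? i j x))))
        ≡⟨ sumUpTo-∑ (m Γ) (λ i x → sumUpTo (n Γ) (λ j → sign i * (+ q) ^ j * 𝟙 (state? i j x))) ⟩
      ∑ (λ x → sumUpTo (m Γ) (λ i → sumUpTo (n Γ) (λ j → sign i * (+ q) ^ j * 𝟙 (state? i j x))))
        ≡⟨ ∑-cong {A = Subset (m Γ) × Subset (n Γ)} (λ (s , c) → ∑-over-degrees s c) ⟩
      ∑ (λ s → ∑ (λ c → sign ∣ s ∣ * (𝟙 (valid? s c) * (+ q) ^ degree s c)))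
        ≡⟨ ∑-cong (λ s → ∑-*ˡ (sign ∣ s ∣) (λ c → 𝟙 (valid? s c) * (+ q) ^ degree s c)) ⟩
      ∑ (λ s → sign ∣ s ∣ * ∑ (λ c → 𝟙 (valid? s c) * (+ q) ^ degree s c)) ∎

-- Whitney's expansion

module Whitney (Γ : Graph) {k : ℕ} where

  open Components Γ using (respects?)

  proper? : Decidable (λ (f : Vec (Fin k) (n Γ)) → ∀ e → lookup f (src Γ e) ≢ lookup f (tgt Γ e))
  proper? f = all? (λ e → ¬? (lookup f (src Γ e) Fin.≟ lookup f (tgt Γ e)))

  ∑-sign-respecting : ∀ g → ∑ (λ s → sign ∣ s ∣ * 𝟙 (respects? s (lookup g) Fin._≟_))
                            ≡ 𝟙 (proper? g)
  ∑-sign-respecting g = begin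
    ∑ (λ s → sign ∣ s ∣ * 𝟙 (respects? s (lookup g) Fin._≟_))
      ≡⟨ ∑-cong (λ s → cong (sign ∣ s ∣ *_) (trans (sym (∏-𝟙 (λ e → member? e s →-dec mono? e)))
                                                  (∏-cong (λ e → 𝟙-→ (lookup s e) (mono? e))))) ⟩
    ∑ (λ s → sign ∣ s ∣ * ∏ (λ e → if lookup s e then 𝟙 (mono? e) else 1ℤ))
      ≡⟨ ∏-one-minus-expansion (λ e → 𝟙 (mono? e)) ⟩
    ∏ (λ e → 1ℤ + - 𝟙 (mono? e))
      ≡⟨ ∏-cong (λ e → sym (𝟙-¬ (mono? e))) ⟩
    ∏ (λ e → 𝟙 (¬? (mono? e)))
      ≡⟨ ∏-𝟙 (λ e → ¬? (mono? e)) ⟩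
    𝟙 (proper? g) ∎
    where
    mono? : ∀ e → Dec (lookup g (src Γ e) ≡ lookup g (tgt Γ e))
    mono? e = lookup g (src Γ e) Fin.≟ lookup g (tgt Γ e)
    𝟙-→ : ∀ b {P : Set} (p : Dec P) → 𝟙 (T? b →-dec p) ≡ (if b then 𝟙 p else 1ℤ)
    𝟙-→ true  p = refl
    𝟙-→ false p = refl

  ∑-sign-∑-respecting : ∑ (λ s → sign ∣ s ∣ * ∑ (λ g → 𝟙 (respects? s (lookup g) Fin._≟_)))
                        ≡ ∑ (λ g → 𝟙 (proper? g))
  ∑-sign-∑-respecting = begin
    ∑ (λ s → sign ∣ s ∣ * ∑ (λ g → 𝟙 (respects? s (lookup g) Fin._≟_)))
      ≡⟨ ∑-cong (λ s → sym (∑-*ˡ (sign ∣ s ∣) (λ g → 𝟙 (respects? s (lookup g) Fin._≟_)))) ⟩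
    ∑ (λ s → ∑ (λ g → sign ∣ s ∣ * 𝟙 (respects? s (lookup g) Fin._≟_)))
      ≡⟨ ∑-swap (λ s g → sign ∣ s ∣ * 𝟙 (respects? s (lookup g) Fin._≟_)) ⟩
    ∑ (λ g → ∑ (λ s → sign ∣ s ∣ * 𝟙 (respects? s (lookup g) Fin._≟_)))
      ≡⟨ ∑-cong ∑-sign-respecting ⟩
    ∑ (λ g → 𝟙 (proper? g)) ∎

proposition3p1 : (Γ : Graph) → IsSimple Γ → IsConnected Γ → (v₀ : Fin (n Γ))
    → (dim : ℕ → ℕ → ℕ) → (∀ i j → HasCard (ReducedState Γ v₀ i j) (dim i j))
    → (p : ℕ → ℕ) → (∀ k → HasCard (ProperColouring Γ k) (p k))
    → ∀ (q : ℕ) → + (suc q) * eulerChar Γ dim (+ q) ≡ + p (suc q)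
proposition3p1 Γ _ _ v₀ dim dims p colourings q = begin
  + suc q * eulerChar Γ dim (+ q)
    ≡⟨ cong (+ suc q *_) (eulerChar≡∑-valid q dims) ⟩
  + suc q * ∑ (λ s → sign ∣ s ∣ * W s)
    ≡⟨ ∑-*ˡ (+ suc q) (λ s → sign ∣ s ∣ * W s) ⟨
  ∑ (λ s → + suc q * (sign ∣ s ∣ * W s))
    ≡⟨ ∑-cong (λ s → trans (swap-factors (+ suc q) (sign ∣ s ∣) (W s))
                           (cong (sign ∣ s ∣ *_) (BaseComponent.∑-valid≡∑-respecting Γ v₀ s q))) ⟩
  ∑ (λ s → sign ∣ s ∣ * ∑ (λ g → 𝟙 (Components.respects? Γ s (lookup g) Fin._≟_)))
    ≡⟨ ∑-sign-∑-respecting ⟩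
  ∑ (λ g → 𝟙 (proper? g))
    ≡⟨ card≡∑𝟙 proper? (colourings (suc q)) ⟨
  + p (suc q) ∎
  where
  open StateSums Γ v₀
  open BaseComponent Γ v₀ using (valid?; degree)
  open Whitney Γ {suc q}
  W : Subset (m Γ) → ℤ
  W s = ∑ (λ c → 𝟙 (valid? s c) * (+ q) ^ degree s c)
  swap-factors : ∀ a b c → a * (b * c) ≡ b * (a * c)
  swap-factors = solve-∀
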